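{- Let $G$ be a graph without isolated vertices. The graph $D_{\Gamma_t(G)}^t(G)$ is disconnected if and only if $G$ has at least two minimal total dominating sets.
   Context: A total dominating set (TDS) of a graph $G$ without isolated vertices is a set $S\subseteq V(G)$ such that every vertex of $G$ is adjacent to a vertex of $S$. A minimal TDS (MTDS) is a TDS no proper subset of which is a TDS. $\Gamma_t(G)$ is the maximum cardinality of an MTDS. For a positive integer $k$, $D_k^t(G)$ is the graph whose vertices are the TDSs of $G$ of cardinality at most $k$, two being adjacent if and only if one is obtained from the other by adding or deleting a single vertex. -}

module Defs where

open import Data.Nat using (ℕ; _≤_)
open import Data.Fin using (Fin)
open import Data.Fin.Subset using (Subset; _∈_; _∉_; _⊂_; _∪_; ⁅_⁆; ∣_∣)
open import Data.Product using (Σ; ∃; ∃-syntax; _×_; _,_)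
open import Relation.Binary.PropositionalEquality using (_≡_)
open import Relation.Nullary using (¬_; Dec)
open import Data.Sum using (_⊎_)

record Graph (n : ℕ) : Set₁ where
  field
    Adj       : Fin n → Fin n → Set
    Adj-dec   : ∀ u v → Dec (Adj u v)
    Adj-sym   : ∀ {u v} → Adj u v → Adj v u
    Adj-irrefl : ∀ {u} → ¬ Adj u u
open Graph public

NoIsolated : ∀ {n} → Graph n → Set
NoIsolated {n} G = ∀ (v : Fin n) → ∃[ u ] Adj G v u

IsTDS : ∀ {n} → Graph n → Subset n → Set
IsTDS {n} G S = ∀ (v : Fin n) → ∃[ u ] (u ∈ S × Adj G v u)

IsMTDS : ∀ {n} → Graph n → Subset n → Set
IsMTDS {n} G S = IsTDS G S × (∀ (T : Subset n) → T ⊂ S → ¬ IsTDS G T)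

IsUpperTotalDomNumber : ∀ {n} → Graph n → ℕ → Set
IsUpperTotalDomNumber {n} G k =
  (∃[ S ] (IsMTDS G S × ∣ S ∣ ≡ k)) × (∀ (S : Subset n) → IsMTDS G S → ∣ S ∣ ≤ k)

-- The graph D_k^t(G): vertices are TDSs of cardinality at most k.
-- (Vertices are represented by the underlying subsets; proofs of
-- membership are irrelevant to vertex identity.)
IsDVertex : ∀ {n} → Graph n → ℕ → Subset n → Set
IsDVertex G k S = IsTDS G S × ∣ S ∣ ≤ k

AddOne : ∀ {n} → Subset n → Subset n → Set
AddOne {n} S T = ∃[ v ] (v ∉ S × T ≡ S ∪ ⁅ v ⁆)

DAdj : ∀ {n} → Subset n → Subset n → Set
DAdj S T = AddOne S T ⊎ AddOne T S

data DWalk {n} (G : Graph n) (k : ℕ) : Subset n → Subset n → Set where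
  here : ∀ {S} → DWalk G k S S
  step : ∀ {S T U} → DAdj S T → IsDVertex G k T → DWalk G k T U → DWalk G k S U

DConnected : ∀ {n} → Graph n → ℕ → Set
DConnected {n} G k = ∀ (S T : Subset n) → IsDVertex G k S → IsDVertex G k T → DWalk G k S T

AtLeastTwoMTDS : ∀ {n} → Graph n → Set
AtLeastTwoMTDS {n} G =
  ∃[ S ] ∃[ T ] (IsMTDS G S × IsMTDS G T × ¬ (S ≡ T))

-- D_{Γ_t}^t(G) is disconnected iff G has at least two minimal total dominating sets.
--
-- Write k = Γ_t(G) and let M be an MTDS with ∣ M ∣ = k.  Two general facts
-- about the graph D_k^t(G) give the theorem.
--
-- (1) Descent.  From any TDS S one may delete "redundant" vertices (those whose
--     removal leaves a TDS) one at a time; each deletion is an edge of D_k^t(G)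
--     and the size strictly drops, so the process ends at a TDS without
--     redundant vertices, i.e. at an MTDS.  Hence every vertex of D_k^t(G) is
--     joined by a walk to some MTDS, and if the MTDS is unique, D_k^t(G) is
--     connected (walk down from S, then back up to T).
-- (2) Isolation.  An MTDS M with k ≤ ∣ M ∣ is an isolated vertex of D_k^t(G):
--     adding a vertex exceeds the size bound k, deleting one destroys total
--     domination by minimality.  So every walk from M ends at M.
--
-- If there are two distinct MTDSs, one of them differs from M and cannot be
-- reached from M by (2); conversely, if M is the only MTDS, (1) connects
-- D_k^t(G).  Being an MTDS is decidable, which lets us make this case split.

module Submission where

open import Defs
open import Data.Nat using (ℕ; zero; suc; _≤_; _<_)
open import Data.Nat.Properties using (≤-trans; <-≤-trans; <⇒≤; <⇒≱; ≤-refl; ≤-reflexive; ≤-pred)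
open import Data.Fin using (Fin; _≟_)
open import Data.Fin.Properties using (any?; all?)
open import Data.Fin.Subset using (Subset; _∈_; _∉_; _⊆_; _⊂_; _∪_; _─_; _-_; ⁅_⁆; ∣_∣)
open import Data.Fin.Subset.Properties
  using (_∈?_; anySubset?; ⊆-antisym; x∈⁅x⁆; x∈⁅y⁆⇒x≡y; x∈p∪q⁺; x∈p∪q⁻; p⊆p∪q; p─q⊆p;
         x∈p∧x≢y⇒x∈p-y; x∈p⇒p-x⊂p; x∈p⇒∣p-x∣<∣p∣; p⊂q⇒∣p∣<∣q∣)
open import Data.Vec using (_∷_; here; there)
open import Data.Vec.Properties using (≡-dec)
open import Data.Bool.Properties using () renaming (_≟_ to _≟ᵇ_)
open import Data.Product using (∃-syntax; _×_; _,_; proj₁; proj₂)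
open import Data.Sum using (inj₁; inj₂)
open import Relation.Nullary using (¬_; Dec; yes; no)
open import Relation.Nullary.Decidable using (_×-dec_; ¬?; decidable-stable)
open import Data.Empty using (⊥-elim)
open import Function.Bundles using (_⇔_; mk⇔)
open import Relation.Binary.PropositionalEquality using (_≡_; refl; sym; trans; subst)

x∈p─q⇒x∉q : ∀ {n} {x : Fin n} (p q : Subset n) → x ∈ p ─ q → x ∉ q
x∈p─q⇒x∉q (_ ∷ p) (_ ∷ q) (there x∈p─q) (there x∈q) = x∈p─q⇒x∉q p q x∈p─q x∈q

x∉p-x : ∀ {n} (p : Subset n) (x : Fin n) → x ∉ p - x
x∉p-x p x x∈p-x = x∈p─q⇒x∉q p ⁅ x ⁆ x∈p-x (x∈⁅x⁆ x)

p-x∪⁅x⁆≡p : ∀ {n} (p : Subset n) {x : Fin n} → x ∈ p → (p - x) ∪ ⁅ x ⁆ ≡ p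
p-x∪⁅x⁆≡p p {x} x∈p = ⊆-antisym ⊆p p⊆
  where
  ⊆p : (p - x) ∪ ⁅ x ⁆ ⊆ p
  ⊆p {y} y∈ with x∈p∪q⁻ (p - x) ⁅ x ⁆ y∈
  ... | inj₁ y∈p-x = p─q⊆p p ⁅ x ⁆ y∈p-x
  ... | inj₂ y∈⁅x⁆ = subst (_∈ p) (sym (x∈⁅y⁆⇒x≡y x y∈⁅x⁆)) x∈p
  p⊆ : p ⊆ (p - x) ∪ ⁅ x ⁆
  p⊆ {y} y∈p with y ≟ x
  ... | yes refl = x∈p∪q⁺ (inj₂ (x∈⁅x⁆ x))
  ... | no y≢x = x∈p∪q⁺ (inj₁ (x∈p∧x≢y⇒x∈p-y y∈p y≢x))

p⊂p∪⁅x⁆ : ∀ {n} (p : Subset n) {x : Fin n} → x ∉ p → p ⊂ p ∪ ⁅ x ⁆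
p⊂p∪⁅x⁆ p {x} x∉p = p⊆p∪q ⁅ x ⁆ , x , x∈p∪q⁺ (inj₂ (x∈⁅x⁆ x)) , x∉p

DAdj-sym : ∀ {n} {S T : Subset n} → DAdj S T → DAdj T S
DAdj-sym (inj₁ add) = inj₂ add
DAdj-sym (inj₂ del) = inj₁ del

delete-edge : ∀ {n} (S : Subset n) {v} → v ∈ S → DAdj S (S - v)
delete-edge S {v} v∈S = inj₂ (v , x∉p-x S v , sym (p-x∪⁅x⁆≡p S v∈S))

module Walks {n : ℕ} {G : Graph n} {k : ℕ} where

  _++_ : ∀ {S T U} → DWalk G k S T → DWalk G k T U → DWalk G k S U
  here          ++ w′ = w′
  step a vT w   ++ w′ = step a vT (w ++ w′)

  -- The start of a walk is not itself required to be a vertex of D_k^t(G),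
  -- so reversal needs that fact for the original start.
  reverse : ∀ {S T} → IsDVertex G k S → DWalk G k S T → DWalk G k T S
  reverse vS here          = here
  reverse vS (step a vT w) = reverse vT w ++ step (DAdj-sym a) vS here

_≟ˢ_ : ∀ {n} (S T : Subset n) → Dec (S ≡ T)
_≟ˢ_ = ≡-dec _≟ᵇ_

module TotalDomination {n : ℕ} (G : Graph n) where
  open Walks

  IsTDS? : ∀ S → Dec (IsTDS G S)
  IsTDS? S = all? (λ v → any? (λ u → (u ∈? S) ×-dec Adj-dec G v u))

  TDS-⊆ : ∀ {S T} → S ⊆ T → IsTDS G S → IsTDS G T
  TDS-⊆ S⊆T tdsS v with tdsS v
  ... | u , u∈S , v~u = u , S⊆T u∈S , v~u

  HasRedundant : Subset n → Set
  HasRedundant S = ∃[ v ] (v ∈ S × IsTDS G (S - v))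

  HasRedundant? : ∀ S → Dec (HasRedundant S)
  HasRedundant? S = any? (λ v → (v ∈? S) ×-dec IsTDS? (S - v))

  -- By upward closure, a proper TDS subset T ⊂ S yields a redundant vertex
  -- of S (any x ∈ S ∖ T); so a TDS without redundant vertices is minimal.
  irredundant⇒MTDS : ∀ {S} → IsTDS G S → ¬ HasRedundant S → IsMTDS G S
  irredundant⇒MTDS {S} tdsS noRed = tdsS , minimal
    where
    minimal : ∀ T → T ⊂ S → ¬ IsTDS G T
    minimal T (T⊆S , x , x∈S , x∉T) tdsT = noRed (x , x∈S , TDS-⊆ T⊆S-x tdsT)
      where
      T⊆S-x : T ⊆ S - x
      T⊆S-x {y} y∈T = x∈p∧x≢y⇒x∈p-y (T⊆S y∈T) (λ y≡x → x∉T (subst (_∈ T) y≡x y∈T))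

  IsMTDS? : ∀ S → Dec (IsMTDS G S)
  IsMTDS? S with IsTDS? S | HasRedundant? S
  ... | no ¬tds | _ = no (λ mtds → ¬tds (proj₁ mtds))
  ... | yes _ | yes (v , v∈S , tds) = no (λ mtds → proj₂ mtds (S - v) (x∈p⇒p-x⊂p v∈S) tds)
  ... | yes tds | no noRed = yes (irredundant⇒MTDS tds noRed)

  delete-redundant : ∀ {k S v} → IsDVertex G k S → v ∈ S → IsTDS G (S - v) → IsDVertex G k (S - v)
  delete-redundant (_ , ∣S∣≤k) v∈S tdsS-v = tdsS-v , ≤-trans (<⇒≤ (x∈p⇒∣p-x∣<∣p∣ v∈S)) ∣S∣≤k

  -- Descent: every vertex S of D_k^t(G) is joined to some MTDS by deleting
  -- redundant vertices one at a time; d is a strict bound on ∣ S ∣ that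
  -- decreases with every deletion.
  descend : ∀ {k} d S → ∣ S ∣ < d → IsDVertex G k S → ∃[ M ] (IsMTDS G M × DWalk G k S M)
  descend zero    S () _
  descend (suc d) S ∣S∣<1+d vertexS with HasRedundant? S
  ... | no noRed = S , irredundant⇒MTDS (proj₁ vertexS) noRed , here
  ... | yes (v , v∈S , tdsS-v)
      with descend d (S - v) (<-≤-trans (x∈p⇒∣p-x∣<∣p∣ v∈S) (≤-pred ∣S∣<1+d))
                   (delete-redundant vertexS v∈S tdsS-v)
  ...   | M , mtds , walk =
          M , mtds , step (delete-edge S v∈S) (delete-redundant vertexS v∈S tdsS-v) walk

  reaches-MTDS : ∀ {k S} → IsDVertex G k S → ∃[ M ] (IsMTDS G M × DWalk G k S M)
  reaches-MTDS {S = S} = descend (suc ∣ S ∣) S ≤-refl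

  unique-MTDS⇒connected : ∀ {k} M → (∀ S → IsMTDS G S → S ≡ M) → DConnected G k
  unique-MTDS⇒connected {k} M unique S T vertexS vertexT
    with reaches-MTDS vertexS | reaches-MTDS vertexT
  ... | M₁ , mtds₁ , S↝M₁ | M₂ , mtds₂ , T↝M₂ =
        subst (DWalk G k S) M₁≡M₂ S↝M₁ ++ reverse vertexT T↝M₂
    where
    M₁≡M₂ : M₁ ≡ M₂
    M₁≡M₂ = trans (unique M₁ mtds₁) (sym (unique M₂ mtds₂))

  -- An MTDS M with k ≤ ∣ M ∣ is isolated in D_k^t(G): adding a vertex exceeds
  -- the size bound and deleting one leaves a proper subset, which is not a TDS.
  large-MTDS-isolated : ∀ {k M X} → IsMTDS G M → k ≤ ∣ M ∣ → DWalk G k M X → X ≡ M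
  large-MTDS-isolated _ _ here = refl
  large-MTDS-isolated {M = M} _ k≤∣M∣ (step (inj₁ (v , v∉M , refl)) (_ , ∣M∪v∣≤k) _) =
    ⊥-elim (<⇒≱ (p⊂q⇒∣p∣<∣q∣ (p⊂p∪⁅x⁆ M v∉M)) (≤-trans ∣M∪v∣≤k k≤∣M∣))
  large-MTDS-isolated (_ , minimal) _ (step (inj₂ (v , v∉T , refl)) (tdsT , _) _) =
    ⊥-elim (minimal _ (p⊂p∪⁅x⁆ _ v∉T) tdsT)

open TotalDomination

corollary2p3 : ∀ {n : ℕ} (G : Graph n) → NoIsolated G → (k : ℕ) → IsUpperTotalDomNumber G k →
    (¬ DConnected G k) ⇔ AtLeastTwoMTDS G
corollary2p3 G _ k ((M , mtdsM , ∣M∣≡k) , maximum) = mk⇔ disconnected⇒two two⇒disconnected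
  where
  -- In a connected D_k^t(G) every MTDS is reachable from the isolated vertex M.
  connected⇒only-M : DConnected G k → ∀ S → IsMTDS G S → S ≡ M
  connected⇒only-M connected S mtdsS =
    large-MTDS-isolated G mtdsM (≤-reflexive (sym ∣M∣≡k))
      (connected M S (proj₁ mtdsM , ≤-reflexive ∣M∣≡k) (proj₁ mtdsS , maximum S mtdsS))

  two⇒disconnected : AtLeastTwoMTDS G → ¬ DConnected G k
  two⇒disconnected (S , T , mtdsS , mtdsT , S≢T) connected =
    S≢T (trans (connected⇒only-M connected S mtdsS) (sym (connected⇒only-M connected T mtdsT)))

  disconnected⇒two : ¬ DConnected G k → AtLeastTwoMTDS G
  disconnected⇒two disconnected with anySubset? (λ S → IsMTDS? G S ×-dec ¬? (S ≟ˢ M))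
  ... | yes (S , mtdsS , S≢M) = S , M , mtdsS , mtdsM , S≢M
  ... | no none = ⊥-elim (disconnected (unique-MTDS⇒connected G M unique))
    where
    unique : ∀ S → IsMTDS G S → S ≡ M
    unique S mtdsS = decidable-stable (S ≟ˢ M) (λ S≢M → none (S , mtdsS , S≢M))
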